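{- Let $f(x,y)=\alpha x^2+\beta xy+\gamma y^2$ be a positive definite binary quadratic form with coprime integer coefficients, with $\alpha$ odd and coprime to $\Delta(f)$. Then the index (determinant) of the lattice $\mathcal{L}_{f,\alpha}$ in $\mathbb{Z}^2$ equals $4\alpha^3$ if $\beta$ is odd and $\alpha^3$ if $\beta$ is even.
   Context: With $\mathcal{A}_1=4\gamma A-\beta B$, $\mathcal{A}_2=4\beta\gamma A-(\beta^2-\alpha\gamma)B$, $\mathcal{A}_3=4\gamma(\beta^2-\alpha\gamma)A-\beta(\beta^2-2\alpha\gamma)B$, the lattice is $\mathcal{L}_{f,\alpha}=\{(A,B)\in\mathbb{Z}^2:\mathcal{A}_1\equiv0 \pmod{2\alpha},\ \mathcal{A}_2\equiv0\pmod{\alpha^2},\ \mathcal{A}_3\equiv0\pmod{4\alpha^3}\}$. $\Delta(f)=\beta^2-4\alpha\gamma$. -}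

module Defs where

open import Data.Integer using (ℤ; +_; _+_; _-_; _*_; _<_; ∣_∣; 0ℤ)
open import Data.Integer.Divisibility using (_∣_)
open import Data.Integer.GCD using (gcd)
open import Data.Product using (Σ; ∃; _×_; _,_)
open import Relation.Binary.PropositionalEquality using (_≡_)
open import Relation.Nullary using (¬_)
open import Data.Sum using (_⊎_)

form : ℤ → ℤ → ℤ → ℤ → ℤ → ℤ
form α β γ x y = α * x * x + β * x * y + γ * y * y

PositiveDefinite : ℤ → ℤ → ℤ → Set
PositiveDefinite α β γ = ∀ x y → ¬ (x ≡ 0ℤ × y ≡ 0ℤ) → 0ℤ < form α β γ x y

disc : ℤ → ℤ → ℤ → ℤ
disc α β γ = β * β - + 4 * α * γ

Odd : ℤ → Set
Odd n = ¬ (+ 2 ∣ n)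

Even : ℤ → Set
Even n = + 2 ∣ n

𝒜₁ 𝒜₂ 𝒜₃ : ℤ → ℤ → ℤ → ℤ → ℤ → ℤ
𝒜₁ α β γ A B = + 4 * γ * A - β * B
𝒜₂ α β γ A B = + 4 * β * γ * A - (β * β - α * γ) * B
𝒜₃ α β γ A B = + 4 * γ * (β * β - α * γ) * A - β * (β * β - + 2 * α * γ) * B

InL : ℤ → ℤ → ℤ → ℤ × ℤ → Set
InL α β γ (A , B) =
  (+ 2 * α ∣ 𝒜₁ α β γ A B) ×
  (α * α ∣ 𝒜₂ α β γ A B) ×
  (+ 4 * (α * α * α) ∣ 𝒜₃ α β γ A B)

comb : ℤ → ℤ → ℤ × ℤ → ℤ × ℤ → ℤ × ℤ
comb a b (x₁ , y₁) (x₂ , y₂) = (a * x₁ + b * x₂ , a * y₁ + b * y₂)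

det : ℤ × ℤ → ℤ × ℤ → ℤ
det (x₁ , y₁) (x₂ , y₂) = x₁ * y₂ - x₂ * y₁

IsBasis : ℤ → ℤ → ℤ → ℤ × ℤ → ℤ × ℤ → Set
IsBasis α β γ v₁ v₂ =
  InL α β γ v₁ × InL α β γ v₂ ×
  (∀ v → InL α β γ v → ∃ λ a → ∃ λ b → v ≡ comb a b v₁ v₂)

-- the index (= determinant) of L_{f,α} in ℤ² equals d:
-- L has a ℤ-basis v₁, v₂ with |det(v₁,v₂)| = d
HasIndex : ℤ → ℤ → ℤ → ℤ → Set
HasIndex α β γ d =
  Σ (ℤ × ℤ) λ v₁ → Σ (ℤ × ℤ) λ v₂ → IsBasis α β γ v₁ v₂ × (+ ∣ det v₁ v₂ ∣ ≡ d)

module Submission where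

-- Since Δ(f) ≡ β² (mod α), the hypothesis gcd(α, Δ) = 1 makes α prime
-- to β, and α is prime to 2 because it is odd.  Under these conditions the
-- lattice is cut out by ONE congruence  w·A ≡ u·B (mod m)  with u prime to m:
--   * β odd:  m = 4α³ and the congruence is 𝒜₃ ≡ 0 itself;
--   * β = 2q: 𝒜₃ = 4·(w·A − u·B) and the congruence is w·A ≡ u·B (mod α³).
-- In both cases the conditions on 𝒜₁ and 𝒜₂ follow from the one on 𝒜₃
-- (plus the parity of 𝒜₁, automatic for even β and forced by 𝒜₃ for odd β).
-- A lattice {(A,B) : m ∣ w·A − u·B} with gcd(m,u) = 1 has the basis
-- (1, t), (0, m) where u·t ≡ w (mod m), so its index is m.

open import Defs
open import Data.Integer using (ℤ; +_; _*_)
open import Data.Integer.GCD using (gcd)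
open import Data.Integer.Coprimality using (Coprime)
open import Data.Product using (_×_)
open import Relation.Binary.PropositionalEquality using (_≡_)

open import Data.Nat using (suc; z≤n; s≤s) renaming (_+_ to _+ℕ_; _*_ to _*ℕ_)
open import Data.Integer using (_+_; _-_; -_; 0ℤ; 1ℤ; -1ℤ; +[1+_]; -[1+_]; ∣_∣; _<_; _≤_; +≤+; +<+)
import Data.Integer.Properties as ℤP
open import Data.Integer.DivMod using (_%ℕ_; _/ℕ_; n%ℕd<d; a≡a%ℕn+[a/ℕn]*n)
open import Data.Integer.Divisibility.Signed
  using (_∣_; divides; ∣ᵤ⇒∣; ∣⇒∣ᵤ; ∣-refl; ∣-trans; ∣m⇒∣-m; ∣m⇒∣m*n; ∣n⇒∣m*n;
         ∣m∣n⇒∣m-n; ∣m+n∣n⇒∣m; ∣m+n∣m⇒∣n; *-monoʳ-∣; *-cancelˡ-∣)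
open import Data.Integer.Tactic.RingSolver using (solve-∀)
import Data.Nat.Coprimality as ℕC
open import Data.Nat.GCD using (module Bézout)
open import Data.Product using (∃; ∃₂; _,_; proj₁; proj₂)
open import Data.Empty using (⊥-elim)
open import Relation.Binary.PropositionalEquality
  using (sym; trans; cong; cong₂; subst; subst₂; module ≡-Reasoning)

-- (1) Coprimality in Bézout form

-- a and b generate the unit ideal of ℤ; this is the form of coprimality
-- that all divisibility arguments below consume.
Bézout : ℤ → ℤ → Set
Bézout a b = ∃₂ λ x y → x * a + y * b ≡ 1ℤ

bézout-sym : ∀ {a b} → Bézout a b → Bézout b a
bézout-sym {a} {b} (x , y , e) = y , x , trans (ℤP.+-comm (y * b) (x * a)) e

-- Being prime to a is preserved by products: (xa + yb)(x'a + y'c) = 1.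
bézout-*ʳ : ∀ {a b c} → Bézout a b → Bézout a c → Bézout a (b * c)
bézout-*ʳ {a} {b} {c} (x , y , e) (x′ , y′ , e′) =
  x * x′ * a + x * y′ * c + y * b * x′ , y * y′ , trans (expand x a y b x′ y′ c) (cong₂ _*_ e e′)
  where
  expand : ∀ x a y b x′ y′ c →
    (x * x′ * a + x * y′ * c + y * b * x′) * a + (y * y′) * (b * c)
      ≡ (x * a + y * b) * (x′ * a + y′ * c)
  expand = solve-∀

bézout-*ˡ : ∀ {a b c} → Bézout a c → Bézout b c → Bézout (a * b) c
bézout-*ˡ h h′ = bézout-sym (bézout-*ʳ (bézout-sym h) (bézout-sym h′))

bézout-cube : ∀ {a u} → Bézout a u → Bézout (a * a * a) u
bézout-cube h = bézout-*ˡ (bézout-*ˡ h h) h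

bézout-shift : ∀ {a b c} k → c ≡ b + k * a → Bézout a b → Bézout a c
bézout-shift {a} {b} {c} k c≡b+ka (x , y , e) =
  x - y * k , y , trans (cong (λ t → (x - y * k) * a + y * t) c≡b+ka) (trans (regroup x a y b k) e)
  where
  regroup : ∀ x a y b k → (x - y * k) * a + y * (b + k * a) ≡ x * a + y * b
  regroup = solve-∀

bézout-factor : ∀ {a b c} → Bézout a (b * c) → Bézout a b
bézout-factor {a} {b} {c} (x , y , e) = x , y * c , trans (regroup x a y b c) e
  where
  regroup : ∀ x a y b c → x * a + (y * c) * b ≡ x * a + y * (b * c)
  regroup = solve-∀

bézout-rescale : ∀ {a b} s t → Bézout (s * a) (t * b) → Bézout a b
bézout-rescale {a} {b} s t (x , y , e) = x * s , y * t , trans (regroup x s a y t b) e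
  where
  regroup : ∀ x s a y t b → (x * s) * a + (y * t) * b ≡ x * (s * a) + y * (t * b)
  regroup = solve-∀

abs-multiple : ∀ i → ∃ λ s → + ∣ i ∣ ≡ s * i
abs-multiple (+ n) = 1ℤ , sym (ℤP.*-identityˡ (+ n))
abs-multiple -[1+ n ] = -1ℤ , sym (ℤP.-1*i≡-i -[1+ n ])

ℕ-bézout : ∀ {m n} → Bézout.Identity 1 m n → Bézout (+ m) (+ n)
ℕ-bézout {m} {n} (Bézout.+- x y 1+yn≡xm) =
  + x , - + y , rearrange (+ x) (+ m) (+ y) (+ n) (cast x y n m 1+yn≡xm)
  where
  rearrange : ∀ X M Y N → 1ℤ + Y * N ≡ X * M → X * M + (- Y) * N ≡ 1ℤ
  rearrange X M Y N e = trans (cong (λ t → t + (- Y) * N) (sym e)) (cancel Y N)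
    where
    cancel : ∀ Y N → 1ℤ + Y * N + (- Y) * N ≡ 1ℤ
    cancel = solve-∀
  cast : ∀ x y n m → 1 +ℕ y *ℕ n ≡ x *ℕ m → 1ℤ + + y * + n ≡ + x * + m
  cast x y n m e = begin
    1ℤ + + y * + n  ≡⟨ cong (λ z → 1ℤ + z) (sym (ℤP.pos-* y n)) ⟩
    + (1 +ℕ y *ℕ n) ≡⟨ cong +_ e ⟩
    + (x *ℕ m)      ≡⟨ ℤP.pos-* x m ⟩
    + x * + m       ∎
    where open ≡-Reasoning
ℕ-bézout (Bézout.-+ x y e) = bézout-sym (ℕ-bézout (Bézout.+- y x e))

coprime⇒bézout : ∀ a b → Coprime a b → Bézout a b
coprime⇒bézout a b c with abs-multiple a | abs-multiple b
... | s , ∣a∣≡sa | t , ∣b∣≡tb =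
  bézout-rescale s t (subst₂ Bézout ∣a∣≡sa ∣b∣≡tb (ℕ-bézout (ℕC.coprime-Bézout c)))

odd⇒bézout-2 : ∀ a → Odd a → Bézout (+ 2) a
odd⇒bézout-2 a a-odd with a %ℕ 2 | n%ℕd<d a 2 | a≡a%ℕn+[a/ℕn]*n a 2
... | 0 | _ | a≡2k = ⊥-elim (a-odd (∣⇒∣ᵤ (divides (a /ℕ 2) (trans a≡2k (ℤP.+-identityˡ _)))))
... | suc (suc _) | s≤s (s≤s ()) | _
... | 1 | _ | a≡1+2k =
  - (a /ℕ 2) , 1ℤ , trans (cong (λ t → - (a /ℕ 2) * + 2 + 1ℤ * t) a≡1+2k) (cancel (a /ℕ 2))
  where
  cancel : ∀ k → - k * + 2 + 1ℤ * (+ 1 + k * + 2) ≡ 1ℤ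
  cancel = solve-∀

gauss : ∀ {a b c} → Bézout a b → a ∣ b * c → a ∣ c
gauss {a} {b} {c} (x , y , e) (divides q bc≡qa) = divides (x * c + y * q) (begin
  c                       ≡⟨ sym (ℤP.*-identityʳ c) ⟩
  c * 1ℤ                  ≡⟨ cong (c *_) (sym e) ⟩
  c * (x * a + y * b)     ≡⟨ distribute c x a y b ⟩
  x * c * a + y * (b * c) ≡⟨ cong (λ t → x * c * a + y * t) bc≡qa ⟩
  x * c * a + y * (q * a) ≡⟨ collect x c a y q ⟩
  (x * c + y * q) * a     ∎)
  where
  open ≡-Reasoning
  distribute : ∀ c x a y b → c * (x * a + y * b) ≡ x * c * a + y * (b * c)
  distribute = solve-∀
  collect : ∀ x c a y q → x * c * a + y * (q * a) ≡ (x * c + y * q) * a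
  collect = solve-∀

crt : ∀ {a b n} → Bézout a b → a ∣ n → b ∣ n → a * b ∣ n
crt {a} {b} {n} (x , y , e) (divides p n≡pa) (divides q n≡qb) = divides (x * q + y * p) (begin
  n                                 ≡⟨ sym (ℤP.*-identityʳ n) ⟩
  n * 1ℤ                            ≡⟨ cong (n *_) (sym e) ⟩
  n * (x * a + y * b)               ≡⟨ distribute n x a y b ⟩
  x * a * n + y * b * n             ≡⟨ cong₂ (λ s t → x * a * s + y * b * t) n≡qb n≡pa ⟩
  x * a * (q * b) + y * b * (p * a) ≡⟨ collect x a q b y p ⟩
  (x * q + y * p) * (a * b)         ∎)
  where
  open ≡-Reasoning
  distribute : ∀ n x a y b → n * (x * a + y * b) ≡ x * a * n + y * b * n
  distribute = solve-∀
  collect : ∀ x a q b y p → x * a * (q * b) + y * b * (p * a) ≡ (x * q + y * p) * (a * b)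
  collect = solve-∀

bézout-b·[b²+kd] : ∀ {d b c} k → c ≡ b * b + k * d → Bézout d b → Bézout d (b * c)
bézout-b·[b²+kd] k c≡ h = bézout-*ʳ h (bézout-shift k c≡ (bézout-*ʳ h h))

-- (2) Lattices cut out by a single congruence

CutOutBy : (α β γ m w u : ℤ) → Set
CutOutBy α β γ m w u =
  ∀ A B → (InL α β γ (A , B) → m ∣ w * A - u * B) × (m ∣ w * A - u * B → InL α β γ (A , B))

-- With u invertible mod m (u·y ≡ 1), put t = y·w; then (1, t) and (0, m) lie in
-- the lattice and span it, since u·(A·t − B) ≡ w·A − u·B (mod m).  Their
-- determinant is m.
congruence-lattice-index : ∀ α β γ w u {m} → 0ℤ ≤ m → Bézout m u →
  CutOutBy α β γ m w u → HasIndex α β γ m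
congruence-lattice-index α β γ w u {m} m≥0 (x , y , xm+yu≡1) cut =
  (+ 1 , t) , (0ℤ , m) , (proj₂ (cut (+ 1) t) t-solves , proj₂ (cut 0ℤ m) m-solves , spans) , ∣det∣≡m
  where
  open ≡-Reasoning
  t : ℤ
  t = y * w

  t-solves : m ∣ w * + 1 - u * t
  t-solves = divides (w * x) (begin
    w * + 1 - u * (y * w)               ≡⟨ cong (λ s → w * s - u * (y * w)) (sym xm+yu≡1) ⟩
    w * (x * m + y * u) - u * (y * w)   ≡⟨ cancel w x m y u ⟩
    (w * x) * m                         ∎)
    where
    cancel : ∀ w x m y u → w * (x * m + y * u) - u * (y * w) ≡ (w * x) * m
    cancel = solve-∀

  m-solves : m ∣ w * 0ℤ - u * m
  m-solves = divides (- u) (collect w u m)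
    where
    collect : ∀ w u m → w * 0ℤ - u * m ≡ (- u) * m
    collect = solve-∀

  m∣A·t-B : ∀ A B → m ∣ w * A - u * B → m ∣ A * t - B
  m∣A·t-B A B m∣wA-uB = gauss (x , y , xm+yu≡1)
    (subst (m ∣_) (sym (split u A y w B)) (∣m∣n⇒∣m-n m∣wA-uB (∣n⇒∣m*n A t-solves)))
    where
    split : ∀ u A y w B → u * (A * (y * w) - B) ≡ (w * A - u * B) - A * (w * + 1 - u * (y * w))
    split = solve-∀

  spans : ∀ v → InL α β γ v → ∃ λ a → ∃ λ b → v ≡ comb a b (+ 1 , t) (0ℤ , m)
  spans (A , B) A,B∈L = from-quotient (m∣A·t-B A B (proj₁ (cut A B) A,B∈L))
    where
    first-coordinate : ∀ A r → A ≡ A * + 1 + - r * 0ℤ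
    first-coordinate = solve-∀
    undo-difference : ∀ B C → B ≡ C - (C - B)
    undo-difference = solve-∀
    minus-as-plus : ∀ C r m → C - r * m ≡ C + - r * m
    minus-as-plus = solve-∀
    from-quotient : m ∣ A * t - B → ∃ λ a → ∃ λ b → (A , B) ≡ comb a b (+ 1 , t) (0ℤ , m)
    from-quotient (divides r At-B≡rm) = A , - r , cong₂ _,_ (first-coordinate A r) (begin
      B                   ≡⟨ undo-difference B (A * t) ⟩
      A * t - (A * t - B) ≡⟨ cong (λ z → A * t - z) At-B≡rm ⟩
      A * t - r * m       ≡⟨ minus-as-plus (A * t) r m ⟩
      A * t + - r * m     ∎)

  ∣det∣≡m : + ∣ det (+ 1 , t) (0ℤ , m) ∣ ≡ m
  ∣det∣≡m = trans (cong (λ d → + ∣ d ∣) (det≡m m t)) (ℤP.0≤i⇒+∣i∣≡i m≥0)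
    where
    det≡m : ∀ m t → + 1 * m - 0ℤ * t ≡ m
    det≡m = solve-∀

-- (3) The top congruence controls the other two

𝒜₃-via-𝒜₁ : ∀ α β γ A B →
  𝒜₃ α β γ A B ≡ β * β * 𝒜₁ α β γ A B + α * (γ * β * B - γ * 𝒜₁ α β γ A B)
𝒜₃-via-𝒜₁ = identity
  where
  identity : ∀ α β γ A B →
    + 4 * γ * (β * β - α * γ) * A - β * (β * β - + 2 * α * γ) * B
      ≡ β * β * (+ 4 * γ * A - β * B) + α * (γ * β * B - γ * (+ 4 * γ * A - β * B))
  identity = solve-∀

𝒜₃-via-𝒜₂ : ∀ α β γ A B → 𝒜₃ α β γ A B ≡ β * 𝒜₂ α β γ A B - α * γ * 𝒜₁ α β γ A B
𝒜₃-via-𝒜₂ = identity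
  where
  identity : ∀ α β γ A B →
    + 4 * γ * (β * β - α * γ) * A - β * (β * β - + 2 * α * γ) * B
      ≡ β * (+ 4 * β * γ * A - (β * β - α * γ) * B) - α * γ * (+ 4 * γ * A - β * B)
  identity = solve-∀

-- α ∣ 𝒜₃ = β²·𝒜₁ + α·(…) and α ⊥ β give α ∣ 𝒜₁.
α∣𝒜₁ : ∀ {α β γ A B} → Bézout α β → α ∣ 𝒜₃ α β γ A B → α ∣ 𝒜₁ α β γ A B
α∣𝒜₁ {α} {β} {γ} {A} {B} α⊥β α∣𝒜₃ = gauss (bézout-*ʳ α⊥β α⊥β)
  (∣m+n∣n⇒∣m (subst (α ∣_) (𝒜₃-via-𝒜₁ α β γ A B) α∣𝒜₃) (∣m⇒∣m*n _ ∣-refl))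

-- α² ∣ 𝒜₃ = β·𝒜₂ − αγ·𝒜₁ with α ∣ 𝒜₁ and α ⊥ β give α² ∣ 𝒜₂.
α²∣𝒜₂ : ∀ {α β γ A B} → Bézout α β → α * α ∣ 𝒜₃ α β γ A B → α ∣ 𝒜₁ α β γ A B →
  α * α ∣ 𝒜₂ α β γ A B
α²∣𝒜₂ {α} {β} {γ} {A} {B} α⊥β α²∣𝒜₃ (divides k 𝒜₁≡kα) = gauss (bézout-*ˡ α⊥β α⊥β)
  (∣m+n∣n⇒∣m (subst (α * α ∣_) (𝒜₃-via-𝒜₂ α β γ A B) α²∣𝒜₃) (∣m⇒∣-m α²∣αγ𝒜₁))
  where
  α²∣αγ𝒜₁ : α * α ∣ α * γ * 𝒜₁ α β γ A B
  α²∣αγ𝒜₁ = divides (γ * k) (trans (cong (α * γ *_) 𝒜₁≡kα) (regroup α γ k))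
    where
    regroup : ∀ α γ k → α * γ * (k * α) ≡ γ * k * (α * α)
    regroup = solve-∀

top-congruence⇒InL : ∀ {α β γ A B} → Bézout α β → Bézout (+ 2) α →
  + 4 * (α * α * α) ∣ 𝒜₃ α β γ A B → + 2 ∣ 𝒜₁ α β γ A B → InL α β γ (A , B)
top-congruence⇒InL {α} {β} {γ} {A} {B} α⊥β 2⊥α 4α³∣𝒜₃ 2∣𝒜₁ =
  ∣⇒∣ᵤ (crt 2⊥α 2∣𝒜₁ α∣𝒜₁′) , ∣⇒∣ᵤ α²∣𝒜₂′ , ∣⇒∣ᵤ 4α³∣𝒜₃
  where
  α∣4α³ : α ∣ + 4 * (α * α * α)
  α∣4α³ = divides (+ 4 * (α * α)) (regroup α)
    where
    regroup : ∀ α → + 4 * (α * α * α) ≡ + 4 * (α * α) * α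
    regroup = solve-∀
  α²∣4α³ : α * α ∣ + 4 * (α * α * α)
  α²∣4α³ = divides (+ 4 * α) (regroup α)
    where
    regroup : ∀ α → + 4 * (α * α * α) ≡ + 4 * α * (α * α)
    regroup = solve-∀
  α∣𝒜₁′ : α ∣ 𝒜₁ α β γ A B
  α∣𝒜₁′ = α∣𝒜₁ {α} {β} {γ} {A} {B} α⊥β (∣-trans α∣4α³ 4α³∣𝒜₃)
  α²∣𝒜₂′ : α * α ∣ 𝒜₂ α β γ A B
  α²∣𝒜₂′ = α²∣𝒜₂ {α} {β} {γ} {A} {B} α⊥β (∣-trans α²∣4α³ 4α³∣𝒜₃) α∣𝒜₁′

-- (4a) β odd: L_{f,α} = {4α³ ∣ 𝒜₃}

α⊥β[β²-2αγ] : ∀ {α β} γ → Bézout α β → Bézout α (β * (β * β - + 2 * α * γ))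
α⊥β[β²-2αγ] {α} {β} γ = bézout-b·[b²+kd] (- (+ 2 * γ)) (regroup α β γ)
  where
  regroup : ∀ α β γ → β * β - + 2 * α * γ ≡ β * β + - (+ 2 * γ) * α
  regroup = solve-∀

2⊥β[β²-2αγ] : ∀ {β} α γ → Bézout (+ 2) β → Bézout (+ 2) (β * (β * β - + 2 * α * γ))
2⊥β[β²-2αγ] {β} α γ = bézout-b·[b²+kd] (- (α * γ)) (regroup α β γ)
  where
  regroup : ∀ α β γ → β * β - + 2 * α * γ ≡ β * β + - (α * γ) * + 2
  regroup = solve-∀

-- For odd β, 2 ∣ 𝒜₃ = 4(…)·A − β(β² − 2αγ)·B forces 2 ∣ B, hence 2 ∣ 𝒜₁ = 4γA − βB.
odd-parity : ∀ {α β γ A B} → Bézout (+ 2) β → + 2 ∣ 𝒜₃ α β γ A B → + 2 ∣ 𝒜₁ α β γ A B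
odd-parity {α} {β} {γ} {A} {B} 2⊥β 2∣𝒜₃ = 2∣B⇒2∣𝒜₁ (gauss (2⊥β[β²-2αγ] α γ 2⊥β) 2∣uB)
  where
  2∣4⋯A : + 2 ∣ + 4 * γ * (β * β - α * γ) * A
  2∣4⋯A = divides (+ 2 * γ * (β * β - α * γ) * A) (regroup α β γ A)
    where
    regroup : ∀ α β γ A → + 4 * γ * (β * β - α * γ) * A ≡ + 2 * γ * (β * β - α * γ) * A * + 2
    regroup = solve-∀
  2∣uB : + 2 ∣ β * (β * β - + 2 * α * γ) * B
  2∣uB = subst (+ 2 ∣_) (ℤP.neg-involutive _) (∣m⇒∣-m (∣m+n∣m⇒∣n 2∣𝒜₃ 2∣4⋯A))
  2∣B⇒2∣𝒜₁ : + 2 ∣ B → + 2 ∣ 𝒜₁ α β γ A B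
  2∣B⇒2∣𝒜₁ (divides r B≡2r) = divides (+ 2 * γ * A - β * r)
    (trans (cong (λ b → + 4 * γ * A - β * b) B≡2r) (regroup γ A β r))
    where
    regroup : ∀ γ A β r → + 4 * γ * A - β * (r * + 2) ≡ (+ 2 * γ * A - β * r) * + 2
    regroup = solve-∀

odd-index : ∀ {α β γ} → Bézout α β → Bézout (+ 2) α → Bézout (+ 2) β →
  0ℤ ≤ + 4 * (α * α * α) → HasIndex α β γ (+ 4 * (α * α * α))
odd-index {α} {β} {γ} α⊥β 2⊥α 2⊥β 4α³≥0 =
  congruence-lattice-index α β γ (+ 4 * γ * (β * β - α * γ)) (β * (β * β - + 2 * α * γ)) 4α³≥0
    (bézout-*ˡ (bézout-*ˡ 2⊥u 2⊥u) (bézout-cube α⊥u)) cut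
  where
  α⊥u : Bézout α (β * (β * β - + 2 * α * γ))
  α⊥u = α⊥β[β²-2αγ] γ α⊥β
  2⊥u : Bézout (+ 2) (β * (β * β - + 2 * α * γ))
  2⊥u = 2⊥β[β²-2αγ] α γ 2⊥β
  cut : CutOutBy α β γ (+ 4 * (α * α * α)) (+ 4 * γ * (β * β - α * γ)) (β * (β * β - + 2 * α * γ))
  cut A B = (λ A,B∈L → ∣ᵤ⇒∣ (proj₂ (proj₂ A,B∈L))) ,
            (λ 4α³∣𝒜₃ → top-congruence⇒InL α⊥β 2⊥α 4α³∣𝒜₃
                          (odd-parity {α} {β} {γ} {A} {B} 2⊥β (∣-trans 2∣4α³ 4α³∣𝒜₃)))
    where
    2∣4α³ : + 2 ∣ + 4 * (α * α * α)
    2∣4α³ = divides (+ 2 * (α * α * α)) (double α)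
      where
      double : ∀ α → + 4 * (α * α * α) ≡ + 2 * (α * α * α) * + 2
      double = solve-∀

-- (4b) β = 2q: L_{f,α} = {α³ ∣ γ(β² − αγ)·A − q(2q² − αγ)·B}

𝒜₁-even : ∀ α γ q A B → 𝒜₁ α (q * + 2) γ A B ≡ (+ 2 * γ * A - q * B) * + 2
𝒜₁-even = identity
  where
  identity : ∀ α γ q A B → + 4 * γ * A - q * + 2 * B ≡ (+ 2 * γ * A - q * B) * + 2
  identity = solve-∀

𝒜₃-even : ∀ α γ q A B → 𝒜₃ α (q * + 2) γ A B ≡
  + 4 * (γ * ((q * + 2) * (q * + 2) - α * γ) * A - q * (+ 2 * q * q - α * γ) * B)
𝒜₃-even = identity
  where
  identity : ∀ α γ q A B →
    + 4 * γ * ((q * + 2) * (q * + 2) - α * γ) * A - q * + 2 * ((q * + 2) * (q * + 2) - + 2 * α * γ) * B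
      ≡ + 4 * (γ * ((q * + 2) * (q * + 2) - α * γ) * A - q * (+ 2 * q * q - α * γ) * B)
  identity = solve-∀

α⊥q[2q²-αγ] : ∀ {α q} γ → Bézout α (+ 2) → Bézout α q → Bézout α (q * (+ 2 * q * q - α * γ))
α⊥q[2q²-αγ] {α} {q} γ α⊥2 α⊥q = bézout-*ʳ α⊥q
  (bézout-shift (- γ) (regroup α γ q) (bézout-*ʳ (bézout-*ʳ α⊥2 α⊥q) α⊥q))
  where
  regroup : ∀ α γ q → + 2 * q * q - α * γ ≡ + 2 * q * q + - γ * α
  regroup = solve-∀

even-index : ∀ {α γ q} → Bézout α (q * + 2) → Bézout (+ 2) α →
  0ℤ ≤ α * α * α → HasIndex α (q * + 2) γ (α * α * α)
even-index {α} {γ} {q} α⊥2q 2⊥α α³≥0 =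
  congruence-lattice-index α (q * + 2) γ
    (γ * ((q * + 2) * (q * + 2) - α * γ)) (q * (+ 2 * q * q - α * γ)) α³≥0
    (bézout-cube (α⊥q[2q²-αγ] {α} {q} γ (bézout-sym 2⊥α) (bézout-factor α⊥2q))) cut
  where
  cut : CutOutBy α (q * + 2) γ (α * α * α)
          (γ * ((q * + 2) * (q * + 2) - α * γ)) (q * (+ 2 * q * q - α * γ))
  cut A B =
    (λ A,B∈L → *-cancelˡ-∣ (+ 4)
                 (subst (+ 4 * (α * α * α) ∣_) (𝒜₃-even α γ q A B) (∣ᵤ⇒∣ (proj₂ (proj₂ A,B∈L))))) ,
    (λ α³∣⋯ → top-congruence⇒InL α⊥2q 2⊥α
                (subst (+ 4 * (α * α * α) ∣_) (sym (𝒜₃-even α γ q A B)) (*-monoʳ-∣ (+ 4) α³∣⋯))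
                (divides (+ 2 * γ * A - q * B) (𝒜₁-even α γ q A B)))

cube-nonneg : ∀ {a} → 0ℤ < a → 0ℤ ≤ a * a * a
cube-nonneg {+[1+ n ]} _ = +≤+ z≤n
cube-nonneg {+ 0} (+<+ ())

four-cube-nonneg : ∀ {a} → 0ℤ < a → 0ℤ ≤ + 4 * (a * a * a)
four-cube-nonneg {+[1+ n ]} _ = +≤+ z≤n
four-cube-nonneg {+ 0} (+<+ ())

-- Δ = β² − 4αγ ≡ β² (mod α), so α ⊥ Δ gives α ⊥ β.
α⊥disc⇒α⊥β : ∀ {α β γ} → Bézout α (disc α β γ) → Bézout α β
α⊥disc⇒α⊥β {α} {β} {γ} α⊥Δ = bézout-factor (bézout-shift (+ 4 * γ) (regroup α β γ) α⊥Δ)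
  where
  regroup : ∀ α β γ → β * β ≡ β * β - + 4 * α * γ + + 4 * γ * α
  regroup = solve-∀

proposition7p3 : (α β γ : ℤ) → PositiveDefinite α β γ →
    gcd (gcd α β) γ ≡ + 1 → Odd α → Coprime α (disc α β γ) →
    (Odd β → HasIndex α β γ (+ 4 * (α * α * α))) ×
    (Even β → HasIndex α β γ (α * α * α))
proposition7p3 α β γ f-pd _ α-odd α⊥Δ =
  (λ β-odd → odd-index α⊥β 2⊥α (odd⇒bézout-2 β β-odd) (four-cube-nonneg α>0)) ,
  β-even
  where
  α⊥β : Bézout α β
  α⊥β = α⊥disc⇒α⊥β (coprime⇒bézout α (disc α β γ) α⊥Δ)
  2⊥α : Bézout (+ 2) α
  2⊥α = odd⇒bézout-2 α α-odd
  α>0 : 0ℤ < α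
  α>0 = subst (0ℤ <_) (f[1,0]≡α α β γ) (f-pd (+ 1) 0ℤ (λ { (() , _) }))
    where
    f[1,0]≡α : ∀ α β γ → α * + 1 * + 1 + β * + 1 * 0ℤ + γ * 0ℤ * 0ℤ ≡ α
    f[1,0]≡α = solve-∀
  β-even : Even β → HasIndex α β γ (α * α * α)
  β-even 2∣β = halve (∣ᵤ⇒∣ 2∣β)
    where
    halve : + 2 ∣ β → HasIndex α β γ (α * α * α)
    halve (divides q β≡2q) = subst (λ b → HasIndex α b γ (α * α * α)) (sym β≡2q)
      (even-index {α} {γ} {q} (subst (Bézout α) β≡2q α⊥β) 2⊥α (cube-nonneg α>0))
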